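{- Let $n$ be a positive integer. Every optimal solution $(x,y,z)$ of the integer program $O_n$ satisfies at least one of the star inequalities $\sum_{S\in 2^{[n]}: i\in S} x_S\le z$ ($i\in[n]$) with equality.
   Context: Let $[n]=\{1,\dots,n\}$ and $2^{[n]}$ its power set. The integer program $O_n$ has binary variables $x_S,y_S\in\{0,1\}$ for all $S\in 2^{[n]}$ and an integer variable $z\in\mathbb{Z}_{\ge 0}$, objective $\max \sum_{S\in 2^{[n]}\setminus\{\emptyset\}} y_S - z$, and constraints: (i) $y_T+y_S\le 1$ for all nonempty $S,T\in 2^{[n]}$ with $S\cap T=\emptyset$; (ii) (star inequalities) $\sum_{S\in 2^{[n]}: i\in S} x_S\le z$ for all $i\in[n]$; (iii) $y_T\le x_S$ for all $S,T\in 2^{[n]}$ with $S\subseteq T$. -}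

module Defs where

open import Data.Nat using (ℕ; zero; suc; _≤_)
open import Data.Bool using (Bool; true; false)
open import Data.Fin using (Fin)
open import Data.Fin.Subset using (Subset; _∈_; _∉_; _⊆_; _∩_; Nonempty; Empty; inside; outside)
open import Data.Vec using (_∷_; [])
open import Data.List using (List; []; _∷_; map; _++_; filter)
open import Data.Nat.ListAction using (sum)
open import Data.Integer using (ℤ; +_; _-_; _≤_)
open import Relation.Nullary using (¬_)
open import Relation.Nullary.Decidable using (Dec; yes; no)
open import Relation.Binary.PropositionalEquality using (_≡_)

-- The power set 2^[n], enumerated as a list (each subset exactly once).
allSubsets : (n : ℕ) → List (Subset n)
allSubsets zero = [] ∷ []
allSubsets (suc n) = map (inside ∷_) (allSubsets n) ++ map (outside ∷_) (allSubsets n)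

val : Bool → ℕ
val true = 1
val false = 0

record Solution (n : ℕ) : Set where
  constructor sol
  field
    x : Subset n → Bool
    y : Subset n → Bool
    z : ℕ
open Solution public

_∈?_ : ∀ {n} (i : Fin n) (S : Subset n) → Dec (i ∈ S)
i ∈? S = Data.Fin.Subset.Properties._∈?_ i S
  where import Data.Fin.Subset.Properties

nonempty? : ∀ {n} (S : Subset n) → Dec (Nonempty S)
nonempty? = Data.Fin.Subset.Properties.nonempty?
  where import Data.Fin.Subset.Properties

starSum : ∀ {n} → Solution n → Fin n → ℕ
starSum s i = sum (map (λ S → val (x s S)) (filter (i ∈?_) (allSubsets _)))

objective : ∀ {n} → Solution n → ℤ
objective s = + sum (map (λ S → val (y s S)) (filter nonempty? (allSubsets _))) - + z s

record Feasible {n : ℕ} (s : Solution n) : Set where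
  field
    disj : ∀ (S T : Subset n) → Nonempty S → Nonempty T → Empty (S ∩ T) →
           val (y s T) Data.Nat.+ val (y s S) Data.Nat.≤ 1
    star : ∀ (i : Fin n) → starSum s i Data.Nat.≤ z s
    mono : ∀ (S T : Subset n) → S ⊆ T → val (y s T) Data.Nat.≤ val (x s S)

Optimal : ∀ {n} → Solution n → Set
Optimal {n} s = Feasible s × (∀ (s' : Solution n) → Feasible s' → objective s' Data.Integer.≤ objective s)
  where open import Data.Product using (_×_)

-- If no star inequality were tight, every star sum would be at most z − 1, so lowering z by one keeps
-- the solution feasible while raising the objective by one; an optimal z is therefore the largest star sum.
module Submission where

open import Defs
open import Data.Nat using (ℕ; suc; pred; _≤_; _<_; NonZero; >-nonZero)
open import Data.Nat.Properties
  using (_≟_; ≮⇒≥; ≤∧≢⇒<; <⇒≤pred; m<n⇒0<n; m≤pred[n]⇒suc[m]≤n; 1+n≰n)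
open import Data.List using (map; filter)
open import Data.Nat.ListAction using (sum)
open import Data.Fin using (Fin; zero)
open import Data.Fin.Properties using (any?)
open import Data.Integer using (+_; +<+)
import Data.Integer as ℤ
open import Data.Integer.Properties using (+-monoʳ-<; neg-mono-<; <⇒≱)
open import Data.Product using (∃; _,_; proj₁)
open import Data.Empty using (⊥-elim)
open import Relation.Nullary using (yes; no)
open import Relation.Binary.PropositionalEquality using (_≡_)

withZ : ∀ {n} → Solution n → ℕ → Solution n
withZ s k = record s { z = k }

withZ-feasible : ∀ {n} {s : Solution n} {k : ℕ} →
                 Feasible s → (∀ i → starSum s i ≤ k) → Feasible (withZ s k)
withZ-feasible feas bound = record { disj = disj ; star = bound ; mono = mono }
  where open Feasible feas

ySum : ∀ {n} → Solution n → ℕ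
ySum s = sum (map (λ S → val (y s S)) (filter nonempty? (allSubsets _)))

objective-withZ-< : ∀ {n} {s : Solution n} {k : ℕ} →
                    k < z s → objective s ℤ.< objective (withZ s k)
objective-withZ-< {s = s} k<z = +-monoʳ-< (+ ySum s) (neg-mono-< (+<+ k<z))

optimal⇒z≤ : ∀ {n} {s : Solution n} {k : ℕ} →
             Optimal s → (∀ i → starSum s i ≤ k) → z s ≤ k
optimal⇒z≤ {s = s} (feas , opt) bound =
  ≮⇒≥ λ k<z → <⇒≱ (objective-withZ-< {s = s} k<z) (opt _ (withZ-feasible feas bound))

mainTheorem3 : ∀ (n : ℕ) → (s : Solution (suc n)) → Optimal s →
    ∃ λ (i : Fin (suc n)) → starSum s i ≡ z s
mainTheorem3 n s optimal with any? (λ i → starSum s i ≟ z s)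
... | yes tight = tight
... | no noneTight = ⊥-elim (1+n≰n (m≤pred[n]⇒suc[m]≤n {{z-nonZero}} z≤pred[z]))
  where
  slack : ∀ i → starSum s i < z s
  slack i = ≤∧≢⇒< (Feasible.star (proj₁ optimal) i) (λ tight → noneTight (i , tight))

  z≤pred[z] : z s ≤ pred (z s)
  z≤pred[z] = optimal⇒z≤ optimal (λ i → <⇒≤pred (slack i))

  z-nonZero : NonZero (z s)
  z-nonZero = >-nonZero (m<n⇒0<n (slack zero))
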